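{- Let $\mathbb J$ be an $H$-subgraph of $\mathbb G$, let $U\subseteq V(\mathbb J)$, and let $\mathrm{Spine}_{\mathbb J}(U)=\{(\mathbb G_i,U_i)\}_{i=1}^s$. Then for all distinct $i,j\in[s]$, no edge of $\mathbb J$ has one endpoint in $V(\mathbb G_i)\setminus U_i$ and the other in $V(\mathbb G_j)\setminus U_j$, and $(V(\mathbb G_i)\setminus U_i)\cap(V(\mathbb G_j)\setminus U_j)=\emptyset$.
   Context: Fixed: a connected graph $H$ and an ordered graph $\mathbb G=(G,\le)$ ($\le$ a total order on $V(G)$); ordered subgraphs carry the restricted order. An $H$-subgraph is an ordered subgraph $\mathbb J$ of $\mathbb G$ isomorphic to $H$. For an $H$-subgraph $\mathbb J$ and an ordered subgraph $\mathbb G'$ of $\mathbb J$, a prefix of $\mathbb G'$ is a non-empty $D\subseteq V(\mathbb G')$ with: (1) every $u\in D$ has a neighbour $v\in V(\mathbb G')\setminus D$ with $uv\in E(\mathbb G')$; (2) $v>u$ for all $u\in D$, $v\in V(\mathbb G')\setminus D$; (3) every vertex of $\mathbb G'$ with a neighbour in $V(\mathbb J)\setminus V(\mathbb G')$ lies in $D$. A useful pair (with respect to $\mathbb J$) is $(\mathbb G',U_{\mathbb G'})$ with $\mathbb G'$ an induced ordered subgraph of $\mathbb J$, $U_{\mathbb G'}$ a prefix of $\mathbb G'$, and $\mathbb J[V(\mathbb G')\setminus U_{\mathbb G'}]$ connected. For $U\subseteq V(\mathbb J)$, $\mathrm{Spine}_{\mathbb J}(U)$ is the family of all useful pairs $(\mathbb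 G_i,U_i)$ with respect to $\mathbb J$ such that $\mathbb G_i$ is an ordered subgraph of $\mathbb J$ and $V(\mathbb G_i)\cap U=U_i$. -}

module Defs where

open import Data.Nat using (ℕ)
open import Data.Fin using (Fin; _<_)
open import Data.Fin.Subset using (Subset; _∈_; _∉_; _∩_; _⊆_)
open import Data.Product using (Σ; ∃; _×_; _,_)
open import Data.Unit using (⊤)
open import Relation.Nullary using (¬_)
open import Relation.Binary.PropositionalEquality using (_≡_)

record Graph (n : ℕ) : Set₁ where
  field
    Adj    : Fin n → Fin n → Set
    sym    : ∀ {u v} → Adj u v → Adj v u
    irrefl : ∀ {u} → ¬ Adj u u

-- An ordered graph: a graph on Fin n, ordered by the standard order of Fin n
-- (every finite totally ordered vertex set is order-isomorphic to this).

record Subgraph {n : ℕ} (G : Graph n) : Set₁ where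
  field
    V     : Subset n
    E     : Fin n → Fin n → Set
    E-sym : ∀ {u v} → E u v → E v u
    E-V   : ∀ {u v} → E u v → u ∈ V × v ∈ V
    E-G   : ∀ {u v} → E u v → Graph.Adj G u v

data Reach {n : ℕ} (A : Fin n → Fin n → Set) (S : Fin n → Set) : Fin n → Fin n → Set where
  here : ∀ {u} → S u → Reach A S u u
  step : ∀ {u v w} → S u → A u v → Reach A S v w → Reach A S u w

ConnectedOn : {n : ℕ} → (Fin n → Fin n → Set) → (Fin n → Set) → Set
ConnectedOn A S = ∀ u v → S u → S v → Reach A S u v

ConnectedGraph : {k : ℕ} → Graph k → Set
ConnectedGraph H = ConnectedOn (Graph.Adj H) (λ _ → ⊤)

IsomorphicTo : {k n : ℕ} {G : Graph n} → Subgraph G → Graph k → Set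
IsomorphicTo {k} {n} J H =
  Σ (Fin k → Fin n) λ f →
    (∀ a b → f a ≡ f b → a ≡ b)
    × (∀ a → f a ∈ Subgraph.V J)
    × (∀ v → v ∈ Subgraph.V J → ∃ λ a → f a ≡ v)
    × (∀ a b → (Graph.Adj H a b → Subgraph.E J (f a) (f b))
                × (Subgraph.E J (f a) (f b) → Graph.Adj H a b))

HSubgraph : {k n : ℕ} → Graph k → (G : Graph n) → Subgraph G → Set
HSubgraph H G J = IsomorphicTo J H

module _ {n : ℕ} {G : Graph n} (J : Subgraph G) where
  open Subgraph J

  -- D is a prefix of the induced ordered subgraph J[W] (W ⊆ V(J)).
  record IsPrefix (W D : Subset n) : Set where
    field
      nonempty : ∃ λ u → u ∈ D
      D⊆W      : D ⊆ W
      cond1    : ∀ u → u ∈ D → ∃ λ v → v ∈ W × v ∉ D × E u v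
      cond2    : ∀ u v → u ∈ D → v ∈ W → v ∉ D → u < v
      cond3    : ∀ u → u ∈ W → (∃ λ v → v ∈ V × v ∉ W × E u v) → u ∈ D

  record UsefulPair (W D : Subset n) : Set where
    field
      W⊆V       : W ⊆ V
      prefix    : IsPrefix W D
      connected : ConnectedOn E (λ x → x ∈ W × x ∉ D)

  -- (J[W], D) ∈ Spine_J(U).
  InSpine : Subset n → Subset n → Subset n → Set
  InSpine U W D = UsefulPair W D × (W ∩ U ≡ D)

{-# OPTIONS --safe #-}
module Submission where

-- The core W ∖ D of a spine pair (J[W], D) avoids U, because D = W ∩ U.
-- By prefix condition (3) every J-neighbour of a core vertex lies in W, so a
-- neighbour outside U is again a core vertex. Cores are connected, hence two
-- cores that share a vertex, or are joined by an edge, coincide. Finally a pair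
-- is determined by its core: by condition (1) each vertex of D has a neighbour
-- in the core, which puts it in the other W as well, and then D = W ∩ U.

open import Defs
open import Data.Nat using (ℕ)
open import Data.Fin using (Fin)
open import Data.Fin.Subset using (Subset; _∈_; _∉_; _⊆_; _∩_)
open import Data.Fin.Subset.Properties using (_∈?_; ⊆-antisym; x∈p∩q⁺; x∈p∩q⁻)
open import Data.Empty using (⊥-elim)
open import Data.Product using (_×_; _,_; proj₁; proj₂)
open import Relation.Nullary using (¬_; yes; no)
open import Relation.Binary.PropositionalEquality using (_≡_; subst; sym; trans; cong)

Reach-source : ∀ {n} {A : Fin n → Fin n → Set} {S : Fin n → Set} {x y : Fin n} →
  Reach A S x y → S x
Reach-source (here s)     = s
Reach-source (step s _ _) = s

module _ {n : ℕ} {G : Graph n} (J : Subgraph G) where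
  open Subgraph J

  Core : Subset n → Subset n → Fin n → Set
  Core W D x = x ∈ W × x ∉ D

  core-neighbour∈W : ∀ {W D u z} → UsefulPair J W D → Core W D u → E u z → z ∈ W
  core-neighbour∈W {W} {z = z} pair (u∈W , u∉D) uz with z ∈? W
  ... | yes z∈W = z∈W
  ... | no  z∉W = ⊥-elim (u∉D (IsPrefix.cond3 (UsefulPair.prefix pair) _ u∈W
                                 (z , proj₂ (E-V uz) , z∉W , uz)))

  core⊆⇒W⊆ : ∀ {W₁ D₁ W₂ D₂} → UsefulPair J W₁ D₁ → UsefulPair J W₂ D₂ →
    (∀ {x} → Core W₁ D₁ x → Core W₂ D₂ x) → W₁ ⊆ W₂
  core⊆⇒W⊆ {D₁ = D₁} pair₁ pair₂ core⊆ {x} x∈W₁ with x ∈? D₁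
  ... | no  x∉D₁ = proj₁ (core⊆ (x∈W₁ , x∉D₁))
  ... | yes x∈D₁ with IsPrefix.cond1 (UsefulPair.prefix pair₁) x x∈D₁
  ...   | v , v∈W₁ , v∉D₁ , xv = core-neighbour∈W pair₂ (core⊆ (v∈W₁ , v∉D₁)) (E-sym xv)

  module _ (U : Subset n) where

    prefix⊆U : ∀ {W D} → InSpine J U W D → D ⊆ U
    prefix⊆U {W} (_ , W∩U≡D) x∈D =
      proj₂ (x∈p∩q⁻ W U (subst (_ ∈_) (sym W∩U≡D) x∈D))

    core∉U : ∀ {W D x} → InSpine J U W D → Core W D x → x ∉ U
    core∉U (_ , W∩U≡D) (x∈W , x∉D) x∈U = x∉D (subst (_ ∈_) W∩U≡D (x∈p∩q⁺ (x∈W , x∈U)))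

    core-neighbour∈core : ∀ {W D u z} → InSpine J U W D → Core W D u → E u z → z ∉ U →
      Core W D z
    core-neighbour∈core spine u∈core uz z∉U =
      core-neighbour∈W (proj₁ spine) u∈core uz , λ z∈D → z∉U (prefix⊆U spine z∈D)

    Reach-preserves-core : ∀ {W D} {S : Fin n → Set} {y x} → InSpine J U W D →
      (∀ {z} → S z → z ∉ U) → Reach E S y x → Core W D y → Core W D x
    Reach-preserves-core spine S∉U (here _)      y∈core = y∈core
    Reach-preserves-core spine S∉U (step _ yv r) y∈core =
      Reach-preserves-core spine S∉U r
        (core-neighbour∈core spine y∈core yv (S∉U (Reach-source r)))

    meeting-cores-⊆ : ∀ {W₁ D₁ W₂ D₂ y} → InSpine J U W₁ D₁ → InSpine J U W₂ D₂ →
      Core W₁ D₁ y → Core W₂ D₂ y → ∀ {x} → Core W₁ D₁ x → Core W₂ D₂ x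
    meeting-cores-⊆ spine₁ spine₂ y∈core₁ y∈core₂ x∈core₁ =
      Reach-preserves-core spine₂ (core∉U spine₁)
        (UsefulPair.connected (proj₁ spine₁) _ _ y∈core₁ x∈core₁) y∈core₂

    meeting-cores⇒same-pair : ∀ {W₁ D₁ W₂ D₂ y} →
      InSpine J U W₁ D₁ → InSpine J U W₂ D₂ →
      Core W₁ D₁ y → Core W₂ D₂ y → W₁ ≡ W₂ × D₁ ≡ D₂
    meeting-cores⇒same-pair {W₁} {W₂ = W₂} spine₁ spine₂ y∈core₁ y∈core₂ =
      W₁≡W₂ , trans (sym (proj₂ spine₁)) (trans (cong (_∩ U) W₁≡W₂) (proj₂ spine₂))
      where
      W₁≡W₂ : W₁ ≡ W₂
      W₁≡W₂ = ⊆-antisym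
        (core⊆⇒W⊆ (proj₁ spine₁) (proj₁ spine₂) (meeting-cores-⊆ spine₁ spine₂ y∈core₁ y∈core₂))
        (core⊆⇒W⊆ (proj₁ spine₂) (proj₁ spine₁) (meeting-cores-⊆ spine₂ spine₁ y∈core₂ y∈core₁))

    edge-between-cores⇒same-pair : ∀ {W₁ D₁ W₂ D₂ u v} →
      InSpine J U W₁ D₁ → InSpine J U W₂ D₂ →
      Core W₁ D₁ u → Core W₂ D₂ v → E u v → W₁ ≡ W₂ × D₁ ≡ D₂
    edge-between-cores⇒same-pair spine₁ spine₂ u∈core₁ v∈core₂ uv =
      meeting-cores⇒same-pair spine₁ spine₂ u∈core₁
        (core-neighbour∈core spine₂ v∈core₂ (E-sym uv) (core∉U spine₁ u∈core₁))

lemma2 : {k n : ℕ} (H : Graph k) (G : Graph n) → ConnectedGraph H →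
    (J : Subgraph G) → HSubgraph H G J →
    (U : Subset n) → U ⊆ Subgraph.V J →
    (W₁ D₁ W₂ D₂ : Subset n) →
    InSpine J U W₁ D₁ → InSpine J U W₂ D₂ →
    ¬ (W₁ ≡ W₂ × D₁ ≡ D₂) →
    (∀ u v → u ∈ W₁ → u ∉ D₁ → v ∈ W₂ → v ∉ D₂ → ¬ Subgraph.E J u v)
    × (∀ x → ¬ ((x ∈ W₁ × x ∉ D₁) × (x ∈ W₂ × x ∉ D₂)))
lemma2 _ _ _ J _ U _ _ _ _ _ spine₁ spine₂ distinct =
  (λ u v u∈W₁ u∉D₁ v∈W₂ v∉D₂ uv →
     distinct (edge-between-cores⇒same-pair J U spine₁ spine₂ (u∈W₁ , u∉D₁) (v∈W₂ , v∉D₂) uv))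
  , λ x (x∈core₁ , x∈core₂) →
     distinct (meeting-cores⇒same-pair J U spine₁ spine₂ x∈core₁ x∈core₂)
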